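{- Let $\mathcal R$ be a polarized rewrite system such that no atomic proposition is the left hand side both of a negative rule and of a positive rule. Then the relations $\longrightarrow_{ - }$ and $\longrightarrow_{+}$ commute, and cut elimination holds for $\mathcal R$: every proof-term of polarized natural deduction modulo $\mathcal R$ is strongly normalizable, and every sequent provable in polarized classical sequent calculus modulo $\mathcal R$ has a proof that does not use the cut rule.
   Context: Propositions are built from atomic propositions (propositional symbols) and the constant $\bot$ using the binary connectives $\Rightarrow$, $\wedge$, $\vee$; $\neg A$ abbreviates $A\Rightarrow\bot$. A rewrite rule is a pair $P \longrightarrow A$ with $P$ an atomic proposition (its left hand side) and $A$ an arbitrary proposition. A polarized rewrite system $\mathcal R = \langle \mathcal R_{ - }, \mathcal R_{+}\rangle$ is a pair of sets of rewrite rules; rules of $\mathcal R_{ - }$ are called negative, those of $\mathcal R_{+}$ positive. The one-step relations $\longrightarrow^1_{ - }$, $\longrightarrow^1_{+}$ are the least relations on propositions such that: $P \longrightarrow^1_{ - } A$ for every negative rule $P \longrightarrow A$; $P \longrightarrow^1_{+} A$ for every positive rule $P\longrightarrow A$; $A \Rightarrow B \longrightarrow^1_{ - } A' \Rightarrow B$ if $A \longrightarrow^1_{+} A'$, and $A \Rightarrow B \longrightarrow^1_{ - } A \Rightarrow B'$ if $B \longrightarrow^1_{ - } B'$; $A \Rightarrow B \longrightarrow^1_{+} A' \Rightarrow B$ if $A \longrightarrow^1_{ - } A'$, and $A \Rightarrow B \longrightarrow^1_{+} A \Rightarrow B'$ if $B \longrightarrow^1_{+} B'$; for $\circ \in \{\wedge,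 \vee\}$ and $s \in \{ -,+\}$, $A \circ B \longrightarrow^1_{s} A' \circ B$ if $A \longrightarrow^1_{s} A'$, and $A \circ B \longrightarrow^1_{s} A \circ B'$ if $B \longrightarrow^1_{s} B'$. The relations $\longrightarrow_{ - }$, $\longrightarrow_{+}$ are the reflexive-transitive closures of $\longrightarrow^1_{ - }$, $\longrightarrow^1_{+}$; $B \longleftarrow_{s} A$ means $A \longrightarrow_{s} B$. They commute if whenever $A \longleftarrow_{ - } B \longrightarrow_{+} C$ there is $D$ with $A \longrightarrow_{+} D \longleftarrow_{ - } C$. Natural deduction: proof-terms are $\pi ::= \alpha \mid \lambda\alpha\,\pi \mid (\pi_1\,\pi_2) \mid \langle \pi_1,\pi_2\rangle \mid \mathit{fst}(\pi) \mid \mathit{snd}(\pi) \mid i(\pi) \mid j(\pi) \mid \delta(\pi_1, \alpha\pi_2, \beta\pi_3) \mid \delta_\bot(\pi)$ ($\alpha,\beta$ proof variables; $\lambda\alpha$ binds $\alpha$; in $\delta(\pi_1,\alpha\pi_2,\beta\pi_3)$, $\alpha$ is bound in $\pi_2$, $\beta$ in $\pi_3$). With $\Gamma$ a finite set of declarations $\alpha:B$, "$\pi$ is a proof-term of $\Gamma\vdash_{\mathcal R}A$" is defined inductively: $\alpha$ proves $A$ if $\alpha:B\in\Gamma$ and $B\longrightarrow_{ - }C\longleftarrow_{+}A$ for some $C$; if $\pi$ proves $\Gamma,\alpha:A\vdash B$ and $C\longrightarrow_{+}(A\Rightarrow B)$ then $\lambda\alpha\,\pi$ proves $\Gamma\vdash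 C$; if $\pi_1$ proves $\Gamma\vdash C$, $C\longrightarrow_{ - }(A\Rightarrow B)$ and $\pi_2$ proves $\Gamma\vdash A$ then $(\pi_1\,\pi_2)$ proves $\Gamma\vdash B$; if $\pi_1$ proves $\Gamma\vdash A$, $\pi_2$ proves $\Gamma\vdash B$ and $C\longrightarrow_{+}(A\wedge B)$ then $\langle\pi_1,\pi_2\rangle$ proves $\Gamma\vdash C$; if $\pi$ proves $\Gamma\vdash C$ and $C\longrightarrow_{ - }(A\wedge B)$ then $\mathit{fst}(\pi)$ proves $\Gamma\vdash A$ and $\mathit{snd}(\pi)$ proves $\Gamma\vdash B$; if $\pi$ proves $\Gamma\vdash A$ (resp. $\Gamma\vdash B$) and $C\longrightarrow_{+}(A\vee B)$ then $i(\pi)$ (resp. $j(\pi)$) proves $\Gamma\vdash C$; if $\pi_1$ proves $\Gamma\vdash D$, $D\longrightarrow_{ - }(A\vee B)$, $\pi_2$ proves $\Gamma,\alpha:A\vdash C$ and $\pi_3$ proves $\Gamma,\beta:B\vdash C$ then $\delta(\pi_1,\alpha\pi_2,\beta\pi_3)$ proves $\Gamma\vdash C$; if $\pi$ proves $\Gamma\vdash B$ and $B\longrightarrow_{ - }\bot$ then $\delta_\bot(\pi)$ proves $\Gamma\vdash A$ for any $A$. One-step reduction $\triangleright^1$ is the closure under term contexts of $(\lambda\alpha\,\pi_1\;\pi_2)\triangleright[\pi_2/\alpha]\pi_1$, $\mathit{fst}(\langle\pi_1,\pi_2\rangle)\triangleright\pi_1$, $\mathit{snd}(\langle\pi_1,\pi_2\rangle)\triangleright\pi_2$,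 $\delta(i(\pi_1),\alpha\pi_2,\beta\pi_3)\triangleright[\pi_1/\alpha]\pi_2$, $\delta(j(\pi_1),\alpha\pi_2,\beta\pi_3)\triangleright[\pi_1/\beta]\pi_3$; a proof-term is strongly normalizable if no infinite $\triangleright^1$-sequence starts from it. Polarized classical sequent calculus modulo $\mathcal R$: sequents $\Gamma\vdash_{\mathcal R}\Delta$ with $\Gamma,\Delta$ finite multisets of propositions; rules: (axiom) $A\vdash B$ if $A\longrightarrow_{ - }C\longleftarrow_{+}B$ for some $C$; (cut) from $\Gamma,A\vdash\Delta$ and $\Gamma\vdash B,\Delta$ infer $\Gamma\vdash\Delta$ if $A\longleftarrow_{ - }C\longrightarrow_{+}B$ for some $C$; (contr-left) from $\Gamma,B_1,B_2\vdash\Delta$ infer $\Gamma,A\vdash\Delta$ if $A\longrightarrow_{ - }B_1$ and $A\longrightarrow_{ - }B_2$; (contr-right) from $\Gamma\vdash B_1,B_2,\Delta$ infer $\Gamma\vdash A,\Delta$ if $A\longrightarrow_{+}B_1$ and $A\longrightarrow_{+}B_2$; (weak-left) from $\Gamma\vdash\Delta$ infer $\Gamma,A\vdash\Delta$; (weak-right) from $\Gamma\vdash\Delta$ infer $\Gamma\vdash A,\Delta$; ($\Rightarrow$-left) from $\Gamma\vdash A,\Delta$ and $\Gamma,B\vdash\Delta$ infer $\Gamma,C\vdash\Delta$ if $C\longrightarrow_{ - }(A\Rightarrow B)$; ($\Rightarrow$-right) from $\Gamma,A\vdash B,\Delta$ infer $\Gamma\vdash C,\Delta$ if $C\longrightarrow_{+}(A\Rightarrow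 B)$; ($\wedge$-left) from $\Gamma,A,B\vdash\Delta$ infer $\Gamma,C\vdash\Delta$ if $C\longrightarrow_{ - }(A\wedge B)$; ($\wedge$-right) from $\Gamma\vdash A,\Delta$ and $\Gamma\vdash B,\Delta$ infer $\Gamma\vdash C,\Delta$ if $C\longrightarrow_{+}(A\wedge B)$; ($\vee$-left) from $\Gamma,A\vdash\Delta$ and $\Gamma,B\vdash\Delta$ infer $\Gamma,C\vdash\Delta$ if $C\longrightarrow_{ - }(A\vee B)$; ($\vee$-right) from $\Gamma\vdash A,B,\Delta$ infer $\Gamma\vdash C,\Delta$ if $C\longrightarrow_{+}(A\vee B)$; ($\bot$-left) $\Gamma,A\vdash\Delta$ if $A\longrightarrow_{ - }\bot$. -}

module Defs where

open import Data.Nat using (ℕ; zero; suc)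
open import Data.List using (List; []; _∷_)
open import Data.Bool using (Bool; true; false)
open import Data.Product using (Σ; ∃; _×_; _,_)
open import Relation.Binary.PropositionalEquality using (_≡_)
open import Relation.Binary.Construct.Closure.ReflexiveTransitive using (Star)
open import Data.List.Relation.Binary.Permutation.Propositional using (_↭_)

data Form (Atom : Set) : Set where
  atom : Atom → Form Atom
  ⊥′   : Form Atom
  _⇒_  : Form Atom → Form Atom → Form Atom
  _∧_  : Form Atom → Form Atom → Form Atom
  _∨_  : Form Atom → Form Atom → Form Atom

infixr 5 _⇒_
infixr 6 _∨_
infixr 7 _∧_

¬′ : {Atom : Set} → Form Atom → Form Atom
¬′ A = A ⇒ ⊥′

-- Proof-terms (de Bruijn indices for proof variables).
-- lam binds index 0 in its body; in  case t u v  index 0 is bound in u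
-- (the variable α) and in v (the variable β).  inl = i, inr = j,
-- case = δ, botE = δ_⊥.

data Term : Set where
  var  : ℕ → Term
  lam  : Term → Term
  app  : Term → Term → Term
  pair : Term → Term → Term
  fst  : Term → Term
  snd  : Term → Term
  inl  : Term → Term
  inr  : Term → Term
  case : Term → Term → Term → Term
  botE : Term → Term

ext : (ℕ → ℕ) → ℕ → ℕ
ext ρ zero    = zero
ext ρ (suc n) = suc (ρ n)

ren : (ℕ → ℕ) → Term → Term
ren ρ (var n)      = var (ρ n)
ren ρ (lam t)      = lam (ren (ext ρ) t)
ren ρ (app t u)    = app (ren ρ t) (ren ρ u)
ren ρ (pair t u)   = pair (ren ρ t) (ren ρ u)
ren ρ (fst t)      = fst (ren ρ t)
ren ρ (snd t)      = snd (ren ρ t)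
ren ρ (inl t)      = inl (ren ρ t)
ren ρ (inr t)      = inr (ren ρ t)
ren ρ (case t u v) = case (ren ρ t) (ren (ext ρ) u) (ren (ext ρ) v)
ren ρ (botE t)     = botE (ren ρ t)

exts : (ℕ → Term) → ℕ → Term
exts σ zero    = var zero
exts σ (suc n) = ren suc (σ n)

sub : (ℕ → Term) → Term → Term
sub σ (var n)      = σ n
sub σ (lam t)      = lam (sub (exts σ) t)
sub σ (app t u)    = app (sub σ t) (sub σ u)
sub σ (pair t u)   = pair (sub σ t) (sub σ u)
sub σ (fst t)      = fst (sub σ t)
sub σ (snd t)      = snd (sub σ t)
sub σ (inl t)      = inl (sub σ t)
sub σ (inr t)      = inr (sub σ t)
sub σ (case t u v) = case (sub σ t) (sub (exts σ) u) (sub (exts σ) v)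
sub σ (botE t)     = botE (sub σ t)

σ₀ : Term → ℕ → Term
σ₀ u zero    = u
σ₀ u (suc n) = var n

_[_] : Term → Term → Term
t [ u ] = sub (σ₀ u) t

infix 4 _▷_
data _▷_ : Term → Term → Set where
  β-⇒   : ∀ {t u} → app (lam t) u ▷ t [ u ]
  β-fst : ∀ {t u} → fst (pair t u) ▷ t
  β-snd : ∀ {t u} → snd (pair t u) ▷ u
  β-inl : ∀ {t u v} → case (inl t) u v ▷ u [ t ]
  β-inr : ∀ {t u v} → case (inr t) u v ▷ v [ t ]
  ξ-lam   : ∀ {t t′} → t ▷ t′ → lam t ▷ lam t′
  ξ-appl  : ∀ {t t′ u} → t ▷ t′ → app t u ▷ app t′ u
  ξ-appr  : ∀ {t u u′} → u ▷ u′ → app t u ▷ app t u′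
  ξ-pairl : ∀ {t t′ u} → t ▷ t′ → pair t u ▷ pair t′ u
  ξ-pairr : ∀ {t u u′} → u ▷ u′ → pair t u ▷ pair t u′
  ξ-fst   : ∀ {t t′} → t ▷ t′ → fst t ▷ fst t′
  ξ-snd   : ∀ {t t′} → t ▷ t′ → snd t ▷ snd t′
  ξ-inl   : ∀ {t t′} → t ▷ t′ → inl t ▷ inl t′
  ξ-inr   : ∀ {t t′} → t ▷ t′ → inr t ▷ inr t′
  ξ-case₁ : ∀ {t t′ u v} → t ▷ t′ → case t u v ▷ case t′ u v
  ξ-case₂ : ∀ {t u u′ v} → u ▷ u′ → case t u v ▷ case t u′ v
  ξ-case₃ : ∀ {t u v v′} → v ▷ v′ → case t u v ▷ case t u v′
  ξ-botE  : ∀ {t t′} → t ▷ t′ → botE t ▷ botE t′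

data SN (t : Term) : Set where
  sn : (∀ {u} → t ▷ u → SN u) → SN t

record RewriteSystem (Atom : Set) : Set₁ where
  field
    neg : Atom → Form Atom → Set
    pos : Atom → Form Atom → Set
open RewriteSystem public

data Pol : Set where
  ⁻ ⁺ : Pol

flip : Pol → Pol
flip ⁻ = ⁺
flip ⁺ = ⁻

Rules : {Atom : Set} → RewriteSystem Atom → Pol → Atom → Form Atom → Set
Rules R ⁻ = neg R
Rules R ⁺ = pos R

module _ {Atom : Set} (R : RewriteSystem Atom) where

  data Step : Pol → Form Atom → Form Atom → Set where
    rule : ∀ {s P A} → Rules R s P A → Step s (atom P) A
    ⇒l   : ∀ {s A A′ B} → Step (flip s) A A′ → Step s (A ⇒ B) (A′ ⇒ B)
    ⇒r   : ∀ {s A B B′} → Step s B B′ → Step s (A ⇒ B) (A ⇒ B′)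
    ∧l   : ∀ {s A A′ B} → Step s A A′ → Step s (A ∧ B) (A′ ∧ B)
    ∧r   : ∀ {s A B B′} → Step s B B′ → Step s (A ∧ B) (A ∧ B′)
    ∨l   : ∀ {s A A′ B} → Step s A A′ → Step s (A ∨ B) (A′ ∨ B)
    ∨r   : ∀ {s A B B′} → Step s B B′ → Step s (A ∨ B) (A ∨ B′)

  _⟶₋_ : Form Atom → Form Atom → Set
  _⟶₋_ = Star (Step ⁻)

  _⟶₊_ : Form Atom → Form Atom → Set
  _⟶₊_ = Star (Step ⁺)

  Commute : Set
  Commute = ∀ {A B C} → B ⟶₋ A → B ⟶₊ C → ∃ λ D → (A ⟶₊ D) × (C ⟶₋ D)

  data _∋_∶_ : List (Form Atom) → ℕ → Form Atom → Set where
    here  : ∀ {Γ B} → (B ∷ Γ) ∋ zero ∶ B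
    there : ∀ {Γ C n B} → Γ ∋ n ∶ B → (C ∷ Γ) ∋ suc n ∶ B

  data _⊢_∶_ (Γ : List (Form Atom)) : Term → Form Atom → Set where
    var  : ∀ {n A B C} → Γ ∋ n ∶ B → B ⟶₋ C → A ⟶₊ C → Γ ⊢ var n ∶ A
    lam  : ∀ {t A B C} → (A ∷ Γ) ⊢ t ∶ B → C ⟶₊ (A ⇒ B) → Γ ⊢ lam t ∶ C
    app  : ∀ {t u A B C} → Γ ⊢ t ∶ C → C ⟶₋ (A ⇒ B) → Γ ⊢ u ∶ A → Γ ⊢ app t u ∶ B
    pair : ∀ {t u A B C} → Γ ⊢ t ∶ A → Γ ⊢ u ∶ B → C ⟶₊ (A ∧ B) → Γ ⊢ pair t u ∶ C
    fst  : ∀ {t A B C} → Γ ⊢ t ∶ C → C ⟶₋ (A ∧ B) → Γ ⊢ fst t ∶ A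
    snd  : ∀ {t A B C} → Γ ⊢ t ∶ C → C ⟶₋ (A ∧ B) → Γ ⊢ snd t ∶ B
    inl  : ∀ {t A B C} → Γ ⊢ t ∶ A → C ⟶₊ (A ∨ B) → Γ ⊢ inl t ∶ C
    inr  : ∀ {t A B C} → Γ ⊢ t ∶ B → C ⟶₊ (A ∨ B) → Γ ⊢ inr t ∶ C
    case : ∀ {t u v A B C D} → Γ ⊢ t ∶ D → D ⟶₋ (A ∨ B) →
           (A ∷ Γ) ⊢ u ∶ C → (B ∷ Γ) ⊢ v ∶ C → Γ ⊢ case t u v ∶ C
    botE : ∀ {t A B} → Γ ⊢ t ∶ B → B ⟶₋ ⊥′ → Γ ⊢ botE t ∶ A

  -- Sequent Γ ⊢ Δ with Γ, Δ multisets (lists up to permutation, rule `perm`).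
  -- The index `c` says whether the cut rule may be used (true) or not (false).

  data Seq (c : Bool) : List (Form Atom) → List (Form Atom) → Set where
    perm    : ∀ {Γ Γ′ Δ Δ′} → Seq c Γ Δ → Γ ↭ Γ′ → Δ ↭ Δ′ → Seq c Γ′ Δ′
    axiom   : ∀ {A B C} → A ⟶₋ C → B ⟶₊ C → Seq c (A ∷ []) (B ∷ [])
    cut     : ∀ {Γ Δ A B C} → c ≡ true →
              Seq c (A ∷ Γ) Δ → Seq c Γ (B ∷ Δ) → C ⟶₋ A → C ⟶₊ B → Seq c Γ Δ
    contrL  : ∀ {Γ Δ A B₁ B₂} → Seq c (B₁ ∷ B₂ ∷ Γ) Δ → A ⟶₋ B₁ → A ⟶₋ B₂ →
              Seq c (A ∷ Γ) Δ
    contrR  : ∀ {Γ Δ A B₁ B₂} → Seq c Γ (B₁ ∷ B₂ ∷ Δ) → A ⟶₊ B₁ → A ⟶₊ B₂ →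
              Seq c Γ (A ∷ Δ)
    weakL   : ∀ {Γ Δ A} → Seq c Γ Δ → Seq c (A ∷ Γ) Δ
    weakR   : ∀ {Γ Δ A} → Seq c Γ Δ → Seq c Γ (A ∷ Δ)
    ⇒L      : ∀ {Γ Δ A B C} → Seq c Γ (A ∷ Δ) → Seq c (B ∷ Γ) Δ → C ⟶₋ (A ⇒ B) →
              Seq c (C ∷ Γ) Δ
    ⇒R      : ∀ {Γ Δ A B C} → Seq c (A ∷ Γ) (B ∷ Δ) → C ⟶₊ (A ⇒ B) →
              Seq c Γ (C ∷ Δ)
    ∧L      : ∀ {Γ Δ A B C} → Seq c (A ∷ B ∷ Γ) Δ → C ⟶₋ (A ∧ B) → Seq c (C ∷ Γ) Δ
    ∧R      : ∀ {Γ Δ A B C} → Seq c Γ (A ∷ Δ) → Seq c Γ (B ∷ Δ) → C ⟶₊ (A ∧ B) →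
              Seq c Γ (C ∷ Δ)
    ∨L      : ∀ {Γ Δ A B C} → Seq c (A ∷ Γ) Δ → Seq c (B ∷ Γ) Δ → C ⟶₋ (A ∨ B) →
              Seq c (C ∷ Γ) Δ
    ∨R      : ∀ {Γ Δ A B C} → Seq c Γ (A ∷ B ∷ Δ) → C ⟶₊ (A ∨ B) → Seq c Γ (C ∷ Δ)
    ⊥L      : ∀ {Γ Δ A} → A ⟶₋ ⊥′ → Seq c (A ∷ Γ) Δ

-- The hypothesis rules out critical pairs between negative and positive
-- rules, so a negative and a positive one-step rewrite of the same
-- proposition act on disjoint positions and close in one step each; this
-- diamond lifts to the reflexive-transitive closures.
--
-- Both normalisation results are proved by a realisability model in which
-- ⟶₋ can only shrink and ⟶₊ only enlarge the interpretation of a formula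
-- (reducibility candidates of proof-terms for natural deduction; sets of
-- sequents orthogonal, with respect to cut-free provability, to a set of
-- tests for the sequent calculus).  Only atoms see the rewrite rules: an atom
-- with a negative rule is interpreted as small as possible and one with a
-- positive rule as large as possible, and disjointness says no atom is asked
-- for both.  Every rule of the calculus is then sound for the model (for
-- cut, C ⟶₋ A and C ⟶₊ B give ⟦ B ⟧ ⊆ ⟦ C ⟧ ⊆ ⟦ A ⟧), and interpreting a proof
-- yields strong normalisation, resp. a cut-free proof.

module Submission where

open import Defs
open import Algebra.Bundles using (CommutativeMonoid)
open import Algebra.Construct.DirectProduct using () renaming (commutativeMonoid to ×-commutativeMonoid)
open import Data.Bool using (true; false)
open import Data.Empty using (⊥; ⊥-elim)
open import Data.List using (List; []; _∷_)
open import Data.List.Properties using (++-identityʳ)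
open import Data.List.Relation.Binary.Permutation.Propositional as ↭ using (_↭_; ↭-refl; ↭-reflexive)
open import Data.List.Relation.Binary.Permutation.Propositional.Properties using (++-commutativeMonoid)
open import Data.Nat using (ℕ; zero; suc)
open import Data.Product using (∃; ∃₂; _×_; _,_; proj₁; proj₂)
open import Data.Unit using (⊤; tt)
open import Function using (_∘_)
open import Level using (0ℓ)
open import Relation.Binary.Core using (Rel)
open import Relation.Binary.Definitions using (Reflexive; Transitive; _Respects_)
open import Relation.Binary.PropositionalEquality
  using (_≡_; refl; sym; trans; cong; cong₂; subst; _≗_; module ≡-Reasoning)
open import Relation.Binary.Construct.Closure.ReflexiveTransitive using (Star; ε; _◅_; _◅◅_; fold)
open import Relation.Unary using (Pred; _⊆_; _∩_; U)

Diamond : ∀ {a ℓ₁ ℓ₂} {A : Set a} → Rel A ℓ₁ → Rel A ℓ₂ → Set _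
Diamond _⟶₁_ _⟶₂_ = ∀ {a b c} → a ⟶₁ b → a ⟶₂ c → ∃ λ d → b ⟶₂ d × c ⟶₁ d

module _ {a ℓ₁ ℓ₂} {A : Set a} {_⟶₁_ : Rel A ℓ₁} {_⟶₂_ : Rel A ℓ₂}
         (diamond : Diamond _⟶₁_ _⟶₂_) where

  diamond-strip : Diamond _⟶₁_ (Star _⟶₂_)
  diamond-strip a→b ε = _ , ε , a→b
  diamond-strip a→b (a→c ◅ c→*e) with diamond a→b a→c
  ... | _ , b→d , c→d with diamond-strip c→d c→*e
  ... | _ , d→*f , e→f = _ , b→d ◅ d→*f , e→f

  diamond-star : Diamond (Star _⟶₁_) (Star _⟶₂_)
  diamond-star ε a→*c = _ , a→*c , ε
  diamond-star (a→b ◅ b→*e) a→*c with diamond-strip a→b a→*c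
  ... | _ , b→*d , c→d with diamond-star b→*e b→*d
  ... | _ , e→*f , d→*f = _ , e→*f , c→d ◅ d→*f

module _ {Atom : Set} (R : RewriteSystem Atom) where

  Disjoint : Set
  Disjoint = ∀ (P : Atom) (A B : Form Atom) → neg R P A → pos R P B → ⊥

  data Opposite : Pol → Pol → Set where
    ⁻⁺ : Opposite ⁻ ⁺
    ⁺⁻ : Opposite ⁺ ⁻

  opposite-flip : ∀ {s t} → Opposite s t → Opposite (flip s) (flip t)
  opposite-flip ⁻⁺ = ⁺⁻
  opposite-flip ⁺⁻ = ⁻⁺

  module _ (disjoint : Disjoint) where

    opposite-rules : ∀ {s t P A B} → Opposite s t → Rules R s P A → Rules R t P B → ⊥
    opposite-rules {P = P} {A} {B} ⁻⁺ r r′ = disjoint P A B r r′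
    opposite-rules {P = P} {A} {B} ⁺⁻ r r′ = disjoint P B A r′ r

    step-diamond : ∀ {s t} → Opposite s t → Diamond (Step R s) (Step R t)
    step-diamond o (rule r) (rule r′) = ⊥-elim (opposite-rules o r r′)
    step-diamond o (⇒l a) (⇒l a′) with step-diamond (opposite-flip o) a a′
    ... | _ , b , b′ = _ , ⇒l b , ⇒l b′
    step-diamond o (⇒l a) (⇒r a′) = _ , ⇒r a′ , ⇒l a
    step-diamond o (⇒r a) (⇒l a′) = _ , ⇒l a′ , ⇒r a
    step-diamond o (⇒r a) (⇒r a′) with step-diamond o a a′
    ... | _ , b , b′ = _ , ⇒r b , ⇒r b′
    step-diamond o (∧l a) (∧l a′) with step-diamond o a a′
    ... | _ , b , b′ = _ , ∧l b , ∧l b′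
    step-diamond o (∧l a) (∧r a′) = _ , ∧r a′ , ∧l a
    step-diamond o (∧r a) (∧l a′) = _ , ∧l a′ , ∧r a
    step-diamond o (∧r a) (∧r a′) with step-diamond o a a′
    ... | _ , b , b′ = _ , ∧r b , ∧r b′
    step-diamond o (∨l a) (∨l a′) with step-diamond o a a′
    ... | _ , b , b′ = _ , ∨l b , ∨l b′
    step-diamond o (∨l a) (∨r a′) = _ , ∨r a′ , ∨l a
    step-diamond o (∨r a) (∨l a′) = _ , ∨l a′ , ∨r a
    step-diamond o (∨r a) (∨r a′) with step-diamond o a a′
    ... | _ , b , b′ = _ , ∨r b , ∨r b′

    commute : Commute R
    commute = diamond-star (step-diamond ⁻⁺)

  record Compatible {ℓ} (_≤_ : Rel (Form Atom) ℓ) : Set ℓ where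
    field
      ≤-refl   : Reflexive _≤_
      ≤-trans  : Transitive _≤_
      ⇒-mono   : ∀ {A A′ B B′} → A′ ≤ A → B ≤ B′ → (A ⇒ B) ≤ (A′ ⇒ B′)
      ∧-mono   : ∀ {A A′ B B′} → A ≤ A′ → B ≤ B′ → (A ∧ B) ≤ (A′ ∧ B′)
      ∨-mono   : ∀ {A A′ B B′} → A ≤ A′ → B ≤ B′ → (A ∨ B) ≤ (A′ ∨ B′)
      neg-rule : ∀ {P A} → neg R P A → atom P ≤ A
      pos-rule : ∀ {P A} → pos R P A → A ≤ atom P

    Oriented : Pol → Rel (Form Atom) ℓ
    Oriented ⁻ A B = A ≤ B
    Oriented ⁺ A B = B ≤ A

    step-oriented : ∀ {s A B} → Step R s A B → Oriented s A B
    step-oriented {⁻} (rule r) = neg-rule r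
    step-oriented {⁺} (rule r) = pos-rule r
    step-oriented {⁻} (⇒l a) = ⇒-mono (step-oriented a) ≤-refl
    step-oriented {⁺} (⇒l a) = ⇒-mono (step-oriented a) ≤-refl
    step-oriented {⁻} (⇒r a) = ⇒-mono ≤-refl (step-oriented a)
    step-oriented {⁺} (⇒r a) = ⇒-mono ≤-refl (step-oriented a)
    step-oriented {⁻} (∧l a) = ∧-mono (step-oriented a) ≤-refl
    step-oriented {⁺} (∧l a) = ∧-mono (step-oriented a) ≤-refl
    step-oriented {⁻} (∧r a) = ∧-mono ≤-refl (step-oriented a)
    step-oriented {⁺} (∧r a) = ∧-mono ≤-refl (step-oriented a)
    step-oriented {⁻} (∨l a) = ∨-mono (step-oriented a) ≤-refl
    step-oriented {⁺} (∨l a) = ∨-mono (step-oriented a) ≤-refl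
    step-oriented {⁻} (∨r a) = ∨-mono ≤-refl (step-oriented a)
    step-oriented {⁺} (∨r a) = ∨-mono ≤-refl (step-oriented a)

    ⟶₋⇒≤ : ∀ {A B} → _⟶₋_ R A B → A ≤ B
    ⟶₋⇒≤ = fold _≤_ (λ a → ≤-trans (step-oriented a)) ≤-refl

    ⟶₊⇒≥ : ∀ {A B} → _⟶₊_ R A B → B ≤ A
    ⟶₊⇒≥ = fold (λ A B → B ≤ A) (λ a b → ≤-trans b (step-oriented a)) ≤-refl

cong-case : ∀ {t t′ u u′ v v′ : Term} → t ≡ t′ → u ≡ u′ → v ≡ v′ → case t u v ≡ case t′ u′ v′
cong-case refl refl refl = refl

ext-cong : ∀ {ρ ρ′} → ρ ≗ ρ′ → ext ρ ≗ ext ρ′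
ext-cong e zero    = refl
ext-cong e (suc n) = cong suc (e n)

ren-cong : ∀ {ρ ρ′} → ρ ≗ ρ′ → ren ρ ≗ ren ρ′
ren-cong e (var n)      = cong var (e n)
ren-cong e (lam t)      = cong lam (ren-cong (ext-cong e) t)
ren-cong e (app t u)    = cong₂ app (ren-cong e t) (ren-cong e u)
ren-cong e (pair t u)   = cong₂ pair (ren-cong e t) (ren-cong e u)
ren-cong e (fst t)      = cong fst (ren-cong e t)
ren-cong e (snd t)      = cong snd (ren-cong e t)
ren-cong e (inl t)      = cong inl (ren-cong e t)
ren-cong e (inr t)      = cong inr (ren-cong e t)
ren-cong e (case t u v) =
  cong-case (ren-cong e t) (ren-cong (ext-cong e) u) (ren-cong (ext-cong e) v)
ren-cong e (botE t)     = cong botE (ren-cong e t)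

exts-cong : ∀ {σ τ} → σ ≗ τ → exts σ ≗ exts τ
exts-cong e zero    = refl
exts-cong e (suc n) = cong (ren suc) (e n)

sub-cong : ∀ {σ τ} → σ ≗ τ → sub σ ≗ sub τ
sub-cong e (var n)      = e n
sub-cong e (lam t)      = cong lam (sub-cong (exts-cong e) t)
sub-cong e (app t u)    = cong₂ app (sub-cong e t) (sub-cong e u)
sub-cong e (pair t u)   = cong₂ pair (sub-cong e t) (sub-cong e u)
sub-cong e (fst t)      = cong fst (sub-cong e t)
sub-cong e (snd t)      = cong snd (sub-cong e t)
sub-cong e (inl t)      = cong inl (sub-cong e t)
sub-cong e (inr t)      = cong inr (sub-cong e t)
sub-cong e (case t u v) =
  cong-case (sub-cong e t) (sub-cong (exts-cong e) u) (sub-cong (exts-cong e) v)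
sub-cong e (botE t)     = cong botE (sub-cong e t)

ext-∘ : ∀ ρ ρ′ → ext ρ ∘ ext ρ′ ≗ ext (ρ ∘ ρ′)
ext-∘ ρ ρ′ zero    = refl
ext-∘ ρ ρ′ (suc n) = refl

ren-ren : ∀ ρ ρ′ t → ren ρ (ren ρ′ t) ≡ ren (ρ ∘ ρ′) t
ren-ren-ext : ∀ ρ ρ′ t → ren (ext ρ) (ren (ext ρ′) t) ≡ ren (ext (ρ ∘ ρ′)) t

ren-ren ρ ρ′ (var n)      = refl
ren-ren ρ ρ′ (lam t)      = cong lam (ren-ren-ext ρ ρ′ t)
ren-ren ρ ρ′ (app t u)    = cong₂ app (ren-ren ρ ρ′ t) (ren-ren ρ ρ′ u)
ren-ren ρ ρ′ (pair t u)   = cong₂ pair (ren-ren ρ ρ′ t) (ren-ren ρ ρ′ u)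
ren-ren ρ ρ′ (fst t)      = cong fst (ren-ren ρ ρ′ t)
ren-ren ρ ρ′ (snd t)      = cong snd (ren-ren ρ ρ′ t)
ren-ren ρ ρ′ (inl t)      = cong inl (ren-ren ρ ρ′ t)
ren-ren ρ ρ′ (inr t)      = cong inr (ren-ren ρ ρ′ t)
ren-ren ρ ρ′ (case t u v) =
  cong-case (ren-ren ρ ρ′ t) (ren-ren-ext ρ ρ′ u) (ren-ren-ext ρ ρ′ v)
ren-ren ρ ρ′ (botE t)     = cong botE (ren-ren ρ ρ′ t)

ren-ren-ext ρ ρ′ t = trans (ren-ren (ext ρ) (ext ρ′) t) (ren-cong (ext-∘ ρ ρ′) t)

exts-∘-ext : ∀ σ ρ → exts σ ∘ ext ρ ≗ exts (σ ∘ ρ)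
exts-∘-ext σ ρ zero    = refl
exts-∘-ext σ ρ (suc n) = refl

sub-ren : ∀ σ ρ t → sub σ (ren ρ t) ≡ sub (σ ∘ ρ) t
sub-ren-exts : ∀ σ ρ t → sub (exts σ) (ren (ext ρ) t) ≡ sub (exts (σ ∘ ρ)) t

sub-ren σ ρ (var n)      = refl
sub-ren σ ρ (lam t)      = cong lam (sub-ren-exts σ ρ t)
sub-ren σ ρ (app t u)    = cong₂ app (sub-ren σ ρ t) (sub-ren σ ρ u)
sub-ren σ ρ (pair t u)   = cong₂ pair (sub-ren σ ρ t) (sub-ren σ ρ u)
sub-ren σ ρ (fst t)      = cong fst (sub-ren σ ρ t)
sub-ren σ ρ (snd t)      = cong snd (sub-ren σ ρ t)
sub-ren σ ρ (inl t)      = cong inl (sub-ren σ ρ t)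
sub-ren σ ρ (inr t)      = cong inr (sub-ren σ ρ t)
sub-ren σ ρ (case t u v) =
  cong-case (sub-ren σ ρ t) (sub-ren-exts σ ρ u) (sub-ren-exts σ ρ v)
sub-ren σ ρ (botE t)     = cong botE (sub-ren σ ρ t)

sub-ren-exts σ ρ t = trans (sub-ren (exts σ) (ext ρ) t) (sub-cong (exts-∘-ext σ ρ) t)

ren-∘-exts : ∀ ρ σ → ren (ext ρ) ∘ exts σ ≗ exts (ren ρ ∘ σ)
ren-∘-exts ρ σ zero    = refl
ren-∘-exts ρ σ (suc n) = trans (ren-ren (ext ρ) suc (σ n)) (sym (ren-ren suc ρ (σ n)))

ren-sub : ∀ ρ σ t → ren ρ (sub σ t) ≡ sub (ren ρ ∘ σ) t
ren-sub-exts : ∀ ρ σ t → ren (ext ρ) (sub (exts σ) t) ≡ sub (exts (ren ρ ∘ σ)) t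

ren-sub ρ σ (var n)      = refl
ren-sub ρ σ (lam t)      = cong lam (ren-sub-exts ρ σ t)
ren-sub ρ σ (app t u)    = cong₂ app (ren-sub ρ σ t) (ren-sub ρ σ u)
ren-sub ρ σ (pair t u)   = cong₂ pair (ren-sub ρ σ t) (ren-sub ρ σ u)
ren-sub ρ σ (fst t)      = cong fst (ren-sub ρ σ t)
ren-sub ρ σ (snd t)      = cong snd (ren-sub ρ σ t)
ren-sub ρ σ (inl t)      = cong inl (ren-sub ρ σ t)
ren-sub ρ σ (inr t)      = cong inr (ren-sub ρ σ t)
ren-sub ρ σ (case t u v) =
  cong-case (ren-sub ρ σ t) (ren-sub-exts ρ σ u) (ren-sub-exts ρ σ v)
ren-sub ρ σ (botE t)     = cong botE (ren-sub ρ σ t)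

ren-sub-exts ρ σ t = trans (ren-sub (ext ρ) (exts σ) t) (sub-cong (ren-∘-exts ρ σ) t)

sub-∘-exts : ∀ τ σ → sub (exts τ) ∘ exts σ ≗ exts (sub τ ∘ σ)
sub-∘-exts τ σ zero    = refl
sub-∘-exts τ σ (suc n) = trans (sub-ren (exts τ) suc (σ n)) (sym (ren-sub suc τ (σ n)))

sub-sub : ∀ τ σ t → sub τ (sub σ t) ≡ sub (sub τ ∘ σ) t
sub-sub-exts : ∀ τ σ t → sub (exts τ) (sub (exts σ) t) ≡ sub (exts (sub τ ∘ σ)) t

sub-sub τ σ (var n)      = refl
sub-sub τ σ (lam t)      = cong lam (sub-sub-exts τ σ t)
sub-sub τ σ (app t u)    = cong₂ app (sub-sub τ σ t) (sub-sub τ σ u)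
sub-sub τ σ (pair t u)   = cong₂ pair (sub-sub τ σ t) (sub-sub τ σ u)
sub-sub τ σ (fst t)      = cong fst (sub-sub τ σ t)
sub-sub τ σ (snd t)      = cong snd (sub-sub τ σ t)
sub-sub τ σ (inl t)      = cong inl (sub-sub τ σ t)
sub-sub τ σ (inr t)      = cong inr (sub-sub τ σ t)
sub-sub τ σ (case t u v) =
  cong-case (sub-sub τ σ t) (sub-sub-exts τ σ u) (sub-sub-exts τ σ v)
sub-sub τ σ (botE t)     = cong botE (sub-sub τ σ t)

sub-sub-exts τ σ t = trans (sub-sub (exts τ) (exts σ) t) (sub-cong (sub-∘-exts τ σ) t)

exts-var : exts var ≗ var
exts-var zero    = refl
exts-var (suc n) = refl

sub-var : ∀ t → sub var t ≡ t
sub-var-exts : ∀ t → sub (exts var) t ≡ t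

sub-var (var n)      = refl
sub-var (lam t)      = cong lam (sub-var-exts t)
sub-var (app t u)    = cong₂ app (sub-var t) (sub-var u)
sub-var (pair t u)   = cong₂ pair (sub-var t) (sub-var u)
sub-var (fst t)      = cong fst (sub-var t)
sub-var (snd t)      = cong snd (sub-var t)
sub-var (inl t)      = cong inl (sub-var t)
sub-var (inr t)      = cong inr (sub-var t)
sub-var (case t u v) = cong-case (sub-var t) (sub-var-exts u) (sub-var-exts v)
sub-var (botE t)     = cong botE (sub-var t)

sub-var-exts t = trans (sub-cong exts-var t) (sub-var t)

infixr 5 _•_
_•_ : Term → (ℕ → Term) → ℕ → Term
(u • σ) zero    = u
(u • σ) (suc n) = σ n

sub-exts-[] : ∀ u σ t → (sub (exts σ) t) [ u ] ≡ sub (u • σ) t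
sub-exts-[] u σ t = trans (sub-sub (σ₀ u) (exts σ) t) (sub-cong σ₀-∘-exts t)
  where
  σ₀-∘-exts : sub (σ₀ u) ∘ exts σ ≗ u • σ
  σ₀-∘-exts zero    = refl
  σ₀-∘-exts (suc n) = trans (sub-ren (σ₀ u) suc (σ n)) (sub-var (σ n))

sub-[] : ∀ σ t u → sub σ (t [ u ]) ≡ (sub (exts σ) t) [ sub σ u ]
sub-[] σ t u = begin
  sub σ (t [ u ])               ≡⟨ sub-sub σ (σ₀ u) t ⟩
  sub (sub σ ∘ σ₀ u) t          ≡⟨ sub-cong sub-∘-σ₀ t ⟩
  sub (sub σ u • σ) t           ≡⟨ sym (sub-exts-[] (sub σ u) σ t) ⟩
  (sub (exts σ) t) [ sub σ u ]  ∎
  where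
  open ≡-Reasoning
  sub-∘-σ₀ : sub σ ∘ σ₀ u ≗ sub σ u • σ
  sub-∘-σ₀ zero    = refl
  sub-∘-σ₀ (suc n) = refl

sub-▷ : ∀ σ {t t′} → t ▷ t′ → sub σ t ▷ sub σ t′
sub-▷ σ (β-⇒ {t} {u})       = subst (app _ _ ▷_) (sym (sub-[] σ t u)) β-⇒
sub-▷ σ β-fst               = β-fst
sub-▷ σ β-snd               = β-snd
sub-▷ σ (β-inl {t} {u})     = subst (case _ _ _ ▷_) (sym (sub-[] σ u t)) β-inl
sub-▷ σ (β-inr {t} {v = v}) = subst (case _ _ _ ▷_) (sym (sub-[] σ v t)) β-inr
sub-▷ σ (ξ-lam r)   = ξ-lam (sub-▷ (exts σ) r)
sub-▷ σ (ξ-appl r)  = ξ-appl (sub-▷ σ r)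
sub-▷ σ (ξ-appr r)  = ξ-appr (sub-▷ σ r)
sub-▷ σ (ξ-pairl r) = ξ-pairl (sub-▷ σ r)
sub-▷ σ (ξ-pairr r) = ξ-pairr (sub-▷ σ r)
sub-▷ σ (ξ-fst r)   = ξ-fst (sub-▷ σ r)
sub-▷ σ (ξ-snd r)   = ξ-snd (sub-▷ σ r)
sub-▷ σ (ξ-inl r)   = ξ-inl (sub-▷ σ r)
sub-▷ σ (ξ-inr r)   = ξ-inr (sub-▷ σ r)
sub-▷ σ (ξ-case₁ r) = ξ-case₁ (sub-▷ σ r)
sub-▷ σ (ξ-case₂ r) = ξ-case₂ (sub-▷ (exts σ) r)
sub-▷ σ (ξ-case₃ r) = ξ-case₃ (sub-▷ (exts σ) r)
sub-▷ σ (ξ-botE r)  = ξ-botE (sub-▷ σ r)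

SN-sub⁻¹ : ∀ σ {t} → SN (sub σ t) → SN t
SN-sub⁻¹ σ (sn h) = sn λ r → SN-sub⁻¹ σ (h (sub-▷ σ r))

Neutral : Term → Set
Neutral (lam _)    = ⊥
Neutral (pair _ _) = ⊥
Neutral (inl _)    = ⊥
Neutral (inr _)    = ⊥
Neutral _          = ⊤

infix 4 _▷*_
_▷*_ : Term → Term → Set
_▷*_ = Star _▷_

SN-▷ : ∀ {t t′} → SN t → t ▷ t′ → SN t′
SN-▷ (sn h) r = h r

SN-app⁻¹ : ∀ {t u} → SN (app t u) → SN t
SN-app⁻¹ (sn h) = sn λ r → SN-app⁻¹ (h (ξ-appl r))

SN-fst⁻¹ : ∀ {t} → SN (fst t) → SN t
SN-fst⁻¹ (sn h) = sn λ r → SN-fst⁻¹ (h (ξ-fst r))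

SN-inl : ∀ {t} → SN t → SN (inl t)
SN-inl (sn h) = sn λ { (ξ-inl r) → SN-inl (h r) }

SN-inr : ∀ {t} → SN t → SN (inr t)
SN-inr (sn h) = sn λ { (ξ-inr r) → SN-inr (h r) }

inl-▷*-inl : ∀ {t t′} → inl t ▷* inl t′ → t ▷* t′
inl-▷*-inl ε                = ε
inl-▷*-inl (ξ-inl r ◅ rs)   = r ◅ inl-▷*-inl rs

inl-▷*-inr : ∀ {t t′} → inl t ▷* inr t′ → ⊥
inl-▷*-inr (ξ-inl r ◅ rs) = inl-▷*-inr rs

inr-▷*-inr : ∀ {t t′} → inr t ▷* inr t′ → t ▷* t′
inr-▷*-inr ε                = ε
inr-▷*-inr (ξ-inr r ◅ rs)   = r ◅ inr-▷*-inr rs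

inr-▷*-inl : ∀ {t t′} → inr t ▷* inl t′ → ⊥
inr-▷*-inl (ξ-inr r ◅ rs) = inr-▷*-inl rs

record Candidate : Set₁ where
  field
    mem : Term → Set
    CR₁ : ∀ {t} → mem t → SN t
    CR₂ : ∀ {t t′} → mem t → t ▷ t′ → mem t′
    CR₃ : ∀ {t} → Neutral t → (∀ {t′} → t ▷ t′ → mem t′) → mem t
open Candidate public

infix 4 _∈_
_∈_ : Term → Candidate → Set
t ∈ 𝒜 = mem 𝒜 t

CR₂* : ∀ 𝒜 {t t′} → t ∈ 𝒜 → t ▷* t′ → t′ ∈ 𝒜
CR₂* 𝒜 t∈ ε        = t∈
CR₂* 𝒜 t∈ (r ◅ rs) = CR₂* 𝒜 (CR₂ 𝒜 t∈ r) rs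

var∈ : ∀ 𝒜 {n} → var n ∈ 𝒜
var∈ 𝒜 = CR₃ 𝒜 tt λ ()

data HereditarilyNeutral (t : Term) : Set where
  hn : Neutral t → (∀ {t′} → t ▷ t′ → HereditarilyNeutral t′) → HereditarilyNeutral t

HN-▷ : ∀ {t t′} → HereditarilyNeutral t → t ▷ t′ → HereditarilyNeutral t′
HN-▷ (hn _ h) r = h r

HN⊆ : ∀ 𝒜 {t} → HereditarilyNeutral t → t ∈ 𝒜
HN⊆ 𝒜 (hn n h) = CR₃ 𝒜 n λ r → HN⊆ 𝒜 (h r)

𝒮𝒩 : Candidate
𝒮𝒩 = record { mem = SN ; CR₁ = λ s → s ; CR₂ = SN-▷ ; CR₃ = λ _ h → sn h }

infixr 5 _⇒ᶜ_
infixr 7 _∧ᶜ_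
infixr 6 _∨ᶜ_

_⇒ᶜ_ : Candidate → Candidate → Candidate
𝒜 ⇒ᶜ ℬ = record { mem = M ; CR₁ = cr₁ ; CR₂ = λ h r u∈ → CR₂ ℬ (h u∈) (ξ-appl r) ; CR₃ = cr₃ }
  where
  M : Term → Set
  M t = ∀ {u} → u ∈ 𝒜 → app t u ∈ ℬ
  cr₁ : ∀ {t} → M t → SN t
  cr₁ h = SN-app⁻¹ (CR₁ ℬ (h (var∈ 𝒜 {0})))
  neutral-app : ∀ {t u} → Neutral t → (∀ {t′} → t ▷ t′ → M t′) → SN u → u ∈ 𝒜 → app t u ∈ ℬ
  neutral-app n h (sn hu) u∈ = CR₃ ℬ tt λ
    { β-⇒        → ⊥-elim n
    ; (ξ-appl r) → h r u∈
    ; (ξ-appr r) → neutral-app n h (hu r) (CR₂ 𝒜 u∈ r) }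
  cr₃ : ∀ {t} → Neutral t → (∀ {t′} → t ▷ t′ → M t′) → M t
  cr₃ n h u∈ = neutral-app n h (CR₁ 𝒜 u∈) u∈

_∧ᶜ_ : Candidate → Candidate → Candidate
𝒜 ∧ᶜ ℬ = record
  { mem = M
  ; CR₁ = λ h → SN-fst⁻¹ (CR₁ 𝒜 (proj₁ h))
  ; CR₂ = λ (a , b) r → CR₂ 𝒜 a (ξ-fst r) , CR₂ ℬ b (ξ-snd r)
  ; CR₃ = cr₃ }
  where
  M : Term → Set
  M t = fst t ∈ 𝒜 × snd t ∈ ℬ
  cr₃ : ∀ {t} → Neutral t → (∀ {t′} → t ▷ t′ → M t′) → M t
  cr₃ n h = CR₃ 𝒜 tt (λ { β-fst → ⊥-elim n ; (ξ-fst r) → proj₁ (h r) })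
          , CR₃ ℬ tt (λ { β-snd → ⊥-elim n ; (ξ-snd r) → proj₂ (h r) })

_∨ᶜ_ : Candidate → Candidate → Candidate
𝒜 ∨ᶜ ℬ = record { mem = M ; CR₁ = proj₁ ; CR₂ = cr₂ ; CR₃ = cr₃ }
  where
  M : Term → Set
  M t = SN t × (∀ {a} → t ▷* inl a → a ∈ 𝒜) × (∀ {b} → t ▷* inr b → b ∈ ℬ)
  cr₂ : ∀ {t t′} → M t → t ▷ t′ → M t′
  cr₂ (s , l , r) st = SN-▷ s st , (λ rs → l (st ◅ rs)) , (λ rs → r (st ◅ rs))
  cr₃ : ∀ {t} → Neutral t → (∀ {t′} → t ▷ t′ → M t′) → M t
  cr₃ n h = sn (λ r → proj₁ (h r))
          , (λ { ε → ⊥-elim n ; (r ◅ rs) → proj₁ (proj₂ (h r)) rs })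
          , (λ { ε → ⊥-elim n ; (r ◅ rs) → proj₂ (proj₂ (h r)) rs })

SN-body : ∀ 𝒜 ℬ {t} → (∀ {u} → u ∈ 𝒜 → t [ u ] ∈ ℬ) → SN t
SN-body 𝒜 ℬ body = SN-sub⁻¹ (σ₀ (var 0)) (CR₁ ℬ (body (var∈ 𝒜)))

lam∈ : ∀ 𝒜 ℬ {t} → (∀ {u} → u ∈ 𝒜 → t [ u ] ∈ ℬ) → lam t ∈ 𝒜 ⇒ᶜ ℬ
lam∈ 𝒜 ℬ body u∈ = β-expand (SN-body 𝒜 ℬ body) (CR₁ 𝒜 u∈) body u∈
  where
  β-expand : ∀ {t u} → SN t → SN u → (∀ {v} → v ∈ 𝒜 → t [ v ] ∈ ℬ) → u ∈ 𝒜 → app (lam t) u ∈ ℬ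
  β-expand st@(sn ht) su@(sn hu) body u∈ = CR₃ ℬ tt λ
    { β-⇒                → body u∈
    ; (ξ-appl (ξ-lam r)) → β-expand (ht r) su (λ v∈ → CR₂ ℬ (body v∈) (sub-▷ _ r)) u∈
    ; (ξ-appr r)         → β-expand st (hu r) body (CR₂ 𝒜 u∈ r) }

pair∈ : ∀ 𝒜 ℬ {t u} → t ∈ 𝒜 → u ∈ ℬ → pair t u ∈ 𝒜 ∧ᶜ ℬ
pair∈ 𝒜 ℬ t∈ u∈ = fst-pair (CR₁ 𝒜 t∈) (CR₁ ℬ u∈) t∈ u∈ , snd-pair (CR₁ 𝒜 t∈) (CR₁ ℬ u∈) t∈ u∈
  where
  fst-pair : ∀ {t u} → SN t → SN u → t ∈ 𝒜 → u ∈ ℬ → fst (pair t u) ∈ 𝒜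
  fst-pair st@(sn ht) su@(sn hu) t∈ u∈ = CR₃ 𝒜 tt λ
    { β-fst               → t∈
    ; (ξ-fst (ξ-pairl r)) → fst-pair (ht r) su (CR₂ 𝒜 t∈ r) u∈
    ; (ξ-fst (ξ-pairr r)) → fst-pair st (hu r) t∈ (CR₂ ℬ u∈ r) }
  snd-pair : ∀ {t u} → SN t → SN u → t ∈ 𝒜 → u ∈ ℬ → snd (pair t u) ∈ ℬ
  snd-pair st@(sn ht) su@(sn hu) t∈ u∈ = CR₃ ℬ tt λ
    { β-snd               → u∈
    ; (ξ-snd (ξ-pairl r)) → snd-pair (ht r) su (CR₂ 𝒜 t∈ r) u∈
    ; (ξ-snd (ξ-pairr r)) → snd-pair st (hu r) t∈ (CR₂ ℬ u∈ r) }

inl∈ : ∀ 𝒜 ℬ {t} → t ∈ 𝒜 → inl t ∈ 𝒜 ∨ᶜ ℬ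
inl∈ 𝒜 ℬ t∈ = SN-inl (CR₁ 𝒜 t∈) , (λ rs → CR₂* 𝒜 t∈ (inl-▷*-inl rs)) , λ rs → ⊥-elim (inl-▷*-inr rs)

inr∈ : ∀ 𝒜 ℬ {t} → t ∈ ℬ → inr t ∈ 𝒜 ∨ᶜ ℬ
inr∈ 𝒜 ℬ t∈ = SN-inr (CR₁ ℬ t∈) , (λ rs → ⊥-elim (inr-▷*-inl rs)) , λ rs → CR₂* ℬ t∈ (inr-▷*-inr rs)

case∈ : ∀ 𝒜 ℬ 𝒞 {t u v} → t ∈ 𝒜 ∨ᶜ ℬ →
        (∀ {a} → a ∈ 𝒜 → u [ a ] ∈ 𝒞) → (∀ {b} → b ∈ ℬ → v [ b ] ∈ 𝒞) → case t u v ∈ 𝒞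
case∈ 𝒜 ℬ 𝒞 t∈ left right =
  go (proj₁ t∈) t∈ (SN-body 𝒜 𝒞 left) (SN-body ℬ 𝒞 right) left right
  where
  go : ∀ {t u v} → SN t → t ∈ 𝒜 ∨ᶜ ℬ → SN u → SN v →
       (∀ {a} → a ∈ 𝒜 → u [ a ] ∈ 𝒞) → (∀ {b} → b ∈ ℬ → v [ b ] ∈ 𝒞) → case t u v ∈ 𝒞
  go st@(sn ht) t∈ su@(sn hu) sv@(sn hv) left right = CR₃ 𝒞 tt λ
    { β-inl       → left (proj₁ (proj₂ t∈) ε)
    ; β-inr       → right (proj₂ (proj₂ t∈) ε)
    ; (ξ-case₁ r) → go (ht r) (CR₂ (𝒜 ∨ᶜ ℬ) t∈ r) su sv left right
    ; (ξ-case₂ r) → go st t∈ (hu r) sv (λ a∈ → CR₂ 𝒞 (left a∈) (sub-▷ _ r)) right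
    ; (ξ-case₃ r) → go st t∈ su (hv r) left (λ b∈ → CR₂ 𝒞 (right b∈) (sub-▷ _ r)) }

botE∈ : ∀ 𝒜 {t} → SN t → botE t ∈ 𝒜
botE∈ 𝒜 (sn h) = CR₃ 𝒜 tt λ { (ξ-botE r) → botE∈ 𝒜 (h r) }

module StrongNormalization {Atom : Set} (R : RewriteSystem Atom) (disjoint : Disjoint R) where

  -- Hereditarily neutral terms lie in every candidate, which makes negative
  -- rules sound; every candidate lies in SN, which makes positive rules sound.
  atom-cand : Atom → Candidate
  atom-cand P = record { mem = M ; CR₁ = proj₁ ; CR₂ = cr₂ ; CR₃ = cr₃ }
    where
    M : Term → Set
    M t = SN t × (∀ {A} → neg R P A → HereditarilyNeutral t)
    cr₂ : ∀ {t t′} → M t → t ▷ t′ → M t′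
    cr₂ (s , h) r = SN-▷ s r , λ n → HN-▷ (h n) r
    cr₃ : ∀ {t} → Neutral t → (∀ {t′} → t ▷ t′ → M t′) → M t
    cr₃ n h = sn (λ r → proj₁ (h r)) , λ neg → hn n λ r → proj₂ (h r) neg

  ⟦_⟧ : Form Atom → Candidate
  ⟦ atom P ⟧ = atom-cand P
  ⟦ ⊥′ ⟧     = 𝒮𝒩
  ⟦ A ⇒ B ⟧  = ⟦ A ⟧ ⇒ᶜ ⟦ B ⟧
  ⟦ A ∧ B ⟧  = ⟦ A ⟧ ∧ᶜ ⟦ B ⟧
  ⟦ A ∨ B ⟧  = ⟦ A ⟧ ∨ᶜ ⟦ B ⟧

  _⊑_ : Form Atom → Form Atom → Set
  A ⊑ B = ∀ {t} → t ∈ ⟦ A ⟧ → t ∈ ⟦ B ⟧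

  ⊑-compatible : Compatible R _⊑_
  ⊑-compatible = record
    { ≤-refl   = λ t∈ → t∈
    ; ≤-trans  = λ f g t∈ → g (f t∈)
    ; ⇒-mono   = λ f g h u∈ → g (h (f u∈))
    ; ∧-mono   = λ f g (a , b) → f a , g b
    ; ∨-mono   = λ f g (s , l , r) → s , (λ rs → f (l rs)) , (λ rs → g (r rs))
    ; neg-rule = λ {_} {A} n (_ , h) → HN⊆ ⟦ A ⟧ (h n)
    ; pos-rule = λ {P} {A} p t∈ → CR₁ ⟦ A ⟧ t∈ , λ {A′} n → ⊥-elim (disjoint P A′ A n p)
    }

  open Compatible ⊑-compatible using (⟶₋⇒≤; ⟶₊⇒≥)

  _⊨_ : (ℕ → Term) → List (Form Atom) → Set
  σ ⊨ Γ = ∀ {n B} → _∋_∶_ R Γ n B → σ n ∈ ⟦ B ⟧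

  ⊨-extend : ∀ {σ Γ A u} → u ∈ ⟦ A ⟧ → σ ⊨ Γ → (u • σ) ⊨ (A ∷ Γ)
  ⊨-extend u∈ σ⊨ here      = u∈
  ⊨-extend u∈ σ⊨ (there m) = σ⊨ m

  adequacy : ∀ {Γ t A σ} → _⊢_∶_ R Γ t A → σ ⊨ Γ → sub σ t ∈ ⟦ A ⟧
  adequacy-body : ∀ {Γ t A B σ} → _⊢_∶_ R (A ∷ Γ) t B → σ ⊨ Γ →
                  ∀ {u} → u ∈ ⟦ A ⟧ → (sub (exts σ) t) [ u ] ∈ ⟦ B ⟧

  adequacy (var m r₋ r₊) σ⊨ = ⟶₊⇒≥ r₊ (⟶₋⇒≤ r₋ (σ⊨ m))
  adequacy (lam {A = A} {B} d r) σ⊨ = ⟶₊⇒≥ r (lam∈ ⟦ A ⟧ ⟦ B ⟧ (adequacy-body d σ⊨))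
  adequacy (app d r e) σ⊨ = ⟶₋⇒≤ r (adequacy d σ⊨) (adequacy e σ⊨)
  adequacy (pair {A = A} {B} d e r) σ⊨ = ⟶₊⇒≥ r (pair∈ ⟦ A ⟧ ⟦ B ⟧ (adequacy d σ⊨) (adequacy e σ⊨))
  adequacy (fst d r) σ⊨ = proj₁ (⟶₋⇒≤ r (adequacy d σ⊨))
  adequacy (snd d r) σ⊨ = proj₂ (⟶₋⇒≤ r (adequacy d σ⊨))
  adequacy (inl {A = A} {B} d r) σ⊨ = ⟶₊⇒≥ r (inl∈ ⟦ A ⟧ ⟦ B ⟧ (adequacy d σ⊨))
  adequacy (inr {A = A} {B} d r) σ⊨ = ⟶₊⇒≥ r (inr∈ ⟦ A ⟧ ⟦ B ⟧ (adequacy d σ⊨))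
  adequacy (case {A = A} {B} {C} d r e f) σ⊨ =
    case∈ ⟦ A ⟧ ⟦ B ⟧ ⟦ C ⟧ (⟶₋⇒≤ r (adequacy d σ⊨)) (adequacy-body e σ⊨) (adequacy-body f σ⊨)
  adequacy {A = A} (botE d r) σ⊨ = botE∈ ⟦ A ⟧ (⟶₋⇒≤ r (adequacy d σ⊨))

  adequacy-body {t = t} {B = B} {σ} d σ⊨ {u} u∈ =
    subst (_∈ ⟦ B ⟧) (sym (sub-exts-[] u σ t)) (adequacy d (⊨-extend u∈ σ⊨))

  strong-normalization : ∀ {Γ t A} → _⊢_∶_ R Γ t A → SN t
  strong-normalization {t = t} {A} d =
    subst SN (sub-var t) (CR₁ ⟦ A ⟧ (adequacy d λ {_} {B} _ → var∈ ⟦ B ⟧))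

module CutElimination {Atom : Set} (R : RewriteSystem Atom) (disjoint : Disjoint R) where

  Sequent : Set
  Sequent = List (Form Atom) × List (Form Atom)

  sequent-monoid : CommutativeMonoid 0ℓ 0ℓ
  sequent-monoid =
    ×-commutativeMonoid (++-commutativeMonoid {A = Form Atom})
                        (++-commutativeMonoid {A = Form Atom})

  open CommutativeMonoid sequent-monoid
    using (_≈_; _∙_; assoc; comm; ∙-cong; ∙-congˡ; ∙-congʳ)
    renaming (refl to ≈-refl; sym to ≈-sym; trans to ≈-trans)
  open import Algebra.Solver.CommutativeMonoid sequent-monoid using (solve; _⊜_; _⊕_; id)

  CutFree : Sequent → Set
  CutFree (Γ , Δ) = Seq R false Γ Δ

  resp : CutFree Respects _≈_
  resp (Γ↭ , Δ↭) ⊢c = perm ⊢c Γ↭ Δ↭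

  left right : Form Atom → Sequent
  left A  = A ∷ [] , []
  right A = [] , A ∷ []

  -- _∙_ is concatenation, so (A ∷ Γ , Δ) ∙ c is left A ∙ ((Γ , Δ) ∙ c) on
  -- the nose and the structural rules apply without rearranging.
  weaken : ∀ w {c} → CutFree c → CutFree (w ∙ c)
  weaken ([] , [])    ⊢c = ⊢c
  weaken (A ∷ Γ , Δ)  ⊢c = weakL (weaken (Γ , Δ) ⊢c)
  weaken ([] , B ∷ Δ) ⊢c = weakR (weaken ([] , Δ) ⊢c)

  contract-step : ∀ a c →
    (∀ {e} → CutFree (a ∙ (a ∙ e)) → CutFree (a ∙ e)) →
    (∀ {d} → CutFree ((c ∙ c) ∙ d) → CutFree (c ∙ d)) →
    ∀ {d} → CutFree (((a ∙ c) ∙ (a ∙ c)) ∙ d) → CutFree ((a ∙ c) ∙ d)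
  contract-step a c contract-a contract-c {d} =
    resp (solve 3 (λ a c d → (c ⊕ (a ⊕ d)) ⊜ ((a ⊕ c) ⊕ d)) ≈-refl a c d)
    ∘ contract-c
    ∘ resp (solve 3 (λ a c d → (a ⊕ ((c ⊕ c) ⊕ d)) ⊜ ((c ⊕ c) ⊕ (a ⊕ d))) ≈-refl a c d)
    ∘ contract-a
    ∘ resp (solve 3 (λ a c d → (((a ⊕ c) ⊕ (a ⊕ c)) ⊕ d) ⊜ (a ⊕ (a ⊕ ((c ⊕ c) ⊕ d)))) ≈-refl a c d)

  contract : ∀ c {d} → CutFree ((c ∙ c) ∙ d) → CutFree (c ∙ d)
  contract ([] , [])    = λ ⊢c → ⊢c
  contract (A ∷ Γ , Δ)  =
    contract-step (left A) (Γ , Δ) (λ ⊢c → contrL ⊢c ε ε) (contract (Γ , Δ))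
  contract ([] , B ∷ Δ) =
    contract-step (right B) ([] , Δ) (λ ⊢c → contrR ⊢c ε ε) (contract ([] , Δ))

  contract-self : ∀ c → CutFree (c ∙ c) → CutFree c
  contract-self c =
    resp (solve 1 (λ c → (c ⊕ id) ⊜ c) ≈-refl c)
    ∘ contract c
    ∘ resp (solve 1 (λ c → (c ⊕ c) ⊜ ((c ⊕ c) ⊕ id)) ≈-refl c)

  infix 10 _ᗮ
  _ᗮ : Pred Sequent 0ℓ → Pred Sequent 0ℓ
  (X ᗮ) x = ∀ {y} → X y → CutFree (x ∙ y)

  ᗮ-antitone : ∀ {X Y} → X ⊆ Y → Y ᗮ ⊆ X ᗮ
  ᗮ-antitone X⊆Y x∈ y∈ = x∈ (X⊆Y y∈)

  ⊆ᗮᗮ : ∀ {X} → X ⊆ X ᗮ ᗮ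
  ⊆ᗮᗮ {x = x} x∈ {y} y∈ = resp (comm y x) (y∈ x∈)

  ᗮᗮᗮ⊆ᗮ : ∀ {X} → X ᗮ ᗮ ᗮ ⊆ X ᗮ
  ᗮᗮᗮ⊆ᗮ x∈ y∈ = x∈ (⊆ᗮᗮ y∈)

  ᗮ-resp : ∀ {X} → (X ᗮ) Respects _≈_
  ᗮ-resp x≈x′ x∈ y∈ = resp (∙-congʳ x≈x′) (x∈ y∈)

  ᗮ-weaken : ∀ {X} w {x} → (X ᗮ) x → (X ᗮ) (w ∙ x)
  ᗮ-weaken w {x} x∈ {y} y∈ = resp (≈-sym (assoc w x y)) (weaken w (x∈ y∈))

  Test : Form Atom → Pred Sequent 0ℓ
  ⟦_⟧ : Form Atom → Pred Sequent 0ℓ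

  ⟦ A ⟧ = Test A ᗮ

  -- A test for P closes every hypothesis rewriting to P, as negative rules
  -- require; if P has a positive rule it is moreover a lone conclusion
  -- rewriting to P, as positive rules require.
  Test (atom P) y = (∀ {A} → _⟶₋_ R A (atom P) → CutFree (left A ∙ y))
                  × (∀ {A} → pos R P A → ∃ λ B → _⟶₊_ R B (atom P) × y ≡ right B)
  Test ⊥′         = U
  Test (A ⇒ B) y  = ∃₂ λ c d → ⟦ A ⟧ c × (⟦ B ⟧ ᗮ) d × y ≡ c ∙ d
  Test (A ∧ B)    = (⟦ A ⟧ ∩ ⟦ B ⟧) ᗮ
  Test (A ∨ B)    = ⟦ A ⟧ ᗮ ∩ ⟦ B ⟧ ᗮ

  left∈⟦_⟧ : ∀ A {A′} → _⟶₋_ R A′ A → ⟦ A ⟧ (left A′)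
  right∈⟦_⟧ᗮ : ∀ A {A′} → _⟶₊_ R A′ A → (⟦ A ⟧ ᗮ) (right A′)

  left∈⟦ atom P ⟧ r (closes , _) = closes r
  left∈⟦ ⊥′ ⟧     r _            = ⊥L r
  left∈⟦ A ⇒ B ⟧  r (c , d , c∈ , d∈ , refl) = ⇒L ⊢A ⊢B r
    where
    ⊢A : CutFree (right A ∙ (c ∙ d))
    ⊢A = resp (solve 3 (λ a c d → (d ⊕ (a ⊕ c)) ⊜ (a ⊕ (c ⊕ d))) ≈-refl (right A) c d)
           (weaken d (right∈⟦ A ⟧ᗮ ε c∈))
    ⊢B : CutFree (left B ∙ (c ∙ d))
    ⊢B = resp (solve 3 (λ b c d → (c ⊕ (d ⊕ b)) ⊜ (b ⊕ (c ⊕ d))) ≈-refl (left B) c d)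
           (weaken c (d∈ (left∈⟦ B ⟧ ε)))
  left∈⟦ A ∧ B ⟧ r {y} y∈ =
    ∧L (resp (comm y (left A ∙ left B)) (y∈ {left A ∙ left B} (A∈ , B∈))) r
    where
    A∈ : ⟦ A ⟧ (left A ∙ left B)
    A∈ = ᗮ-resp {Test A} (comm (left B) (left A)) (ᗮ-weaken {Test A} (left B) (left∈⟦ A ⟧ ε))
    B∈ : ⟦ B ⟧ (left A ∙ left B)
    B∈ = ᗮ-weaken {Test B} (left A) (left∈⟦ B ⟧ ε)
  left∈⟦ A ∨ B ⟧ r {y} (A⊥ , B⊥) =
    ∨L (resp (comm y (left A)) (A⊥ (left∈⟦ A ⟧ ε))) (resp (comm y (left B)) (B⊥ (left∈⟦ B ⟧ ε))) r

  right∈⟦ atom P ⟧ᗮ {A′} r {x} x∈ =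
    resp (comm x (right A′)) (x∈ ((λ r′ → axiom r′ r) , λ _ → A′ , r , refl))
  right∈⟦ ⊥′ ⟧ᗮ {A′} r {x} x∈ = resp (comm x (right A′)) (x∈ tt)
  right∈⟦ A ⇒ B ⟧ᗮ r {x} x∈ =
    ⇒R (resp (comm x (left A ∙ right B))
              (x∈ (left A , right B , left∈⟦ A ⟧ ε , right∈⟦ B ⟧ᗮ ε , refl))) r
  right∈⟦ A ∧ B ⟧ᗮ r {x} x∈ =
    ∧R (resp (comm x (right A)) (x∈ {right A} λ (a , _) → right∈⟦ A ⟧ᗮ ε a))
       (resp (comm x (right B)) (x∈ {right B} λ (_ , b) → right∈⟦ B ⟧ᗮ ε b)) r
  right∈⟦ A ∨ B ⟧ᗮ r {x} x∈ =
    ∨R (resp (comm x (right A ∙ right B)) (x∈ {right A ∙ right B} (A⊥ , B⊥))) r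
    where
    A⊥ : (⟦ A ⟧ ᗮ) (right A ∙ right B)
    A⊥ = ᗮ-resp {⟦ A ⟧} (comm (right B) (right A)) (ᗮ-weaken {⟦ A ⟧} (right B) (right∈⟦ A ⟧ᗮ ε))
    B⊥ : (⟦ B ⟧ ᗮ) (right A ∙ right B)
    B⊥ = ᗮ-weaken {⟦ B ⟧} (right A) (right∈⟦ B ⟧ᗮ ε)

  _⊑_ : Form Atom → Form Atom → Set
  A ⊑ B = ⟦ A ⟧ ⊆ ⟦ B ⟧

  neg-rule⊑ : ∀ {P A} → neg R P A → atom P ⊑ A
  neg-rule⊑ {P} {A} n P∈ y∈ =
    P∈ ((λ r → left∈⟦ A ⟧ (r ◅◅ rule n ◅ ε) y∈) , λ p → ⊥-elim (disjoint P A _ n p))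

  pos-rule⊑ : ∀ {P A} → pos R P A → A ⊑ atom P
  pos-rule⊑ {A = A} p {x} A∈ (_ , is-right) with is-right p
  ... | B , r , refl = resp (comm (right B) x) (right∈⟦ A ⟧ᗮ (r ◅◅ rule p ◅ ε) A∈)

  ⊑-compatible : Compatible R _⊑_
  ⊑-compatible = record
    { ≤-refl   = λ x∈ → x∈
    ; ≤-trans  = λ f g x∈ → g (f x∈)
    ; ⇒-mono   = λ f g → ᗮ-antitone λ (c , d , c∈ , d∈ , e) → c , d , f c∈ , ᗮ-antitone g d∈ , e
    ; ∧-mono   = λ f g → ᗮ-antitone (ᗮ-antitone λ (a , b) → f a , g b)
    ; ∨-mono   = λ f g → ᗮ-antitone λ (a , b) → ᗮ-antitone f a , ᗮ-antitone g b
    ; neg-rule = neg-rule⊑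
    ; pos-rule = pos-rule⊑
    }

  open Compatible ⊑-compatible using (⟶₋⇒≤; ⟶₊⇒≥)

  data Sum (I : Form Atom → Pred Sequent 0ℓ) : List (Form Atom) → Sequent → Set where
    []  : Sum I [] ([] , [])
    _∷_ : ∀ {A Γ x a} → I A x → Sum I Γ a → Sum I (A ∷ Γ) (x ∙ a)

  Sum-↭ : ∀ {I Γ Γ′ a} → Γ ↭ Γ′ → Sum I Γ′ a → ∃ λ a′ → Sum I Γ a′ × a′ ≈ a
  Sum-↭ ↭.refl s = _ , s , ≈-refl
  Sum-↭ (↭.prep _ p) (x∈ ∷ s) with Sum-↭ p s
  ... | _ , s′ , a′≈a = _ , x∈ ∷ s′ , ∙-congˡ a′≈a
  Sum-↭ (↭.swap _ _ p) (_∷_ {x = x} x∈ (_∷_ {x = y} {a} y∈ s)) with Sum-↭ p s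
  ... | a′ , s′ , a′≈a = _ , y∈ ∷ (x∈ ∷ s′) , ≈-trans (∙-congˡ {y} (∙-congˡ {x} a′≈a))
          (solve 3 (λ x y a → (y ⊕ (x ⊕ a)) ⊜ (x ⊕ (y ⊕ a))) ≈-refl x y a)
  Sum-↭ (↭.trans p q) s with Sum-↭ q s
  ... | _ , s₁ , ≈₁ with Sum-↭ p s₁
  ... | _ , s₂ , ≈₂ = _ , s₂ , ≈-trans ≈₂ ≈₁

  Hyps Concls : List (Form Atom) → Sequent → Set
  Hyps   = Sum ⟦_⟧
  Concls = Sum λ A → ⟦ A ⟧ ᗮ

  Valid : List (Form Atom) → List (Form Atom) → Set
  Valid Γ Δ = ∀ {a b} → Hyps Γ a → Concls Δ b → CutFree (a ∙ b)

  valid⇒∈⟦⟧ : ∀ {Γ Δ B a b} → Valid Γ (B ∷ Δ) →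
              Hyps Γ a → Concls Δ b → ⟦ B ⟧ (a ∙ b)
  valid⇒∈⟦⟧ {B = B} {a} {b} v Γ∈ Δ∈ = ᗮᗮᗮ⊆ᗮ {Test B} λ {y} y∈ →
    resp (solve 3 (λ a b y → (a ⊕ (y ⊕ b)) ⊜ ((a ⊕ b) ⊕ y)) ≈-refl a b y) (v Γ∈ (y∈ ∷ Δ∈))

  valid⇒∈⟦⟧ᗮ : ∀ {Γ Δ A a b} → Valid (A ∷ Γ) Δ →
               Hyps Γ a → Concls Δ b → (⟦ A ⟧ ᗮ) (a ∙ b)
  valid⇒∈⟦⟧ᗮ {a = a} {b} v Γ∈ Δ∈ {x} x∈ =
    resp (solve 3 (λ a b x → ((x ⊕ a) ⊕ b) ⊜ ((a ⊕ b) ⊕ x)) ≈-refl a b x) (v (x∈ ∷ Γ∈) Δ∈)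

  valid-perm : ∀ {Γ Γ′ Δ Δ′} → Valid Γ Δ → Γ ↭ Γ′ → Δ ↭ Δ′ → Valid Γ′ Δ′
  valid-perm v p q Γ∈ Δ∈ with Sum-↭ p Γ∈ | Sum-↭ q Δ∈
  ... | _ , Γ∈′ , a≈ | _ , Δ∈′ , b≈ = resp (∙-cong a≈ b≈) (v Γ∈′ Δ∈′)

  valid-axiom : ∀ {A B C} → _⟶₋_ R A C → _⟶₊_ R B C → Valid (A ∷ []) (B ∷ [])
  valid-axiom r₋ r₊ (_∷_ {x = x} x∈ []) (_∷_ {x = y} y∈ []) =
    resp (solve 2 (λ x y → (y ⊕ x) ⊜ ((x ⊕ id) ⊕ (y ⊕ id))) ≈-refl x y) (y∈ (⟶₊⇒≥ r₊ (⟶₋⇒≤ r₋ x∈)))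

  valid-cut : ∀ {Γ Δ A B C} → Valid (A ∷ Γ) Δ → Valid Γ (B ∷ Δ) →
              _⟶₋_ R C A → _⟶₊_ R C B → Valid Γ Δ
  valid-cut vA vB r₋ r₊ {a} {b} Γ∈ Δ∈ =
    contract-self (a ∙ b) (valid⇒∈⟦⟧ᗮ vA Γ∈ Δ∈ (⟶₋⇒≤ r₋ (⟶₊⇒≥ r₊ (valid⇒∈⟦⟧ vB Γ∈ Δ∈))))

  valid-contrL : ∀ {Γ Δ A B₁ B₂} → Valid (B₁ ∷ B₂ ∷ Γ) Δ →
                 _⟶₋_ R A B₁ → _⟶₋_ R A B₂ → Valid (A ∷ Γ) Δ
  valid-contrL v r₁ r₂ {b = b} (_∷_ {x = x} {a} x∈ Γ∈) Δ∈ =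
    resp (≈-sym (assoc x a b)) (contract x
      (resp (solve 3 (λ x a b → ((x ⊕ (x ⊕ a)) ⊕ b) ⊜ ((x ⊕ x) ⊕ (a ⊕ b))) ≈-refl x a b)
        (v (⟶₋⇒≤ r₁ x∈ ∷ ⟶₋⇒≤ r₂ x∈ ∷ Γ∈) Δ∈)))

  valid-contrR : ∀ {Γ Δ A B₁ B₂} → Valid Γ (B₁ ∷ B₂ ∷ Δ) →
                 _⟶₊_ R A B₁ → _⟶₊_ R A B₂ → Valid Γ (A ∷ Δ)
  valid-contrR v r₁ r₂ {a} Γ∈ (_∷_ {x = y} {b} y∈ Δ∈) =
    resp (solve 3 (λ y a b → (y ⊕ (a ⊕ b)) ⊜ (a ⊕ (y ⊕ b))) ≈-refl y a b) (contract y
      (resp (solve 3 (λ y a b → (a ⊕ (y ⊕ (y ⊕ b))) ⊜ ((y ⊕ y) ⊕ (a ⊕ b))) ≈-refl y a b)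
        (v Γ∈ (ᗮ-antitone (⟶₊⇒≥ r₁) y∈ ∷ ᗮ-antitone (⟶₊⇒≥ r₂) y∈ ∷ Δ∈))))

  valid-weakL : ∀ {Γ Δ A} → Valid Γ Δ → Valid (A ∷ Γ) Δ
  valid-weakL v {b = b} (_∷_ {x = x} {a} _ Γ∈) Δ∈ = resp (≈-sym (assoc x a b)) (weaken x (v Γ∈ Δ∈))

  valid-weakR : ∀ {Γ Δ A} → Valid Γ Δ → Valid Γ (A ∷ Δ)
  valid-weakR v {a} Γ∈ (_∷_ {x = y} {b} _ Δ∈) =
    resp (solve 3 (λ y a b → (y ⊕ (a ⊕ b)) ⊜ (a ⊕ (y ⊕ b))) ≈-refl y a b) (weaken y (v Γ∈ Δ∈))

  valid-⇒L : ∀ {Γ Δ A B C} → Valid Γ (A ∷ Δ) → Valid (B ∷ Γ) Δ →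
             _⟶₋_ R C (A ⇒ B) → Valid (C ∷ Γ) Δ
  valid-⇒L vA vB r {b = b} (_∷_ {x = x} {a} x∈ Γ∈) Δ∈ =
    resp (solve 3 (λ x a b → ((a ⊕ b) ⊕ x) ⊜ ((x ⊕ a) ⊕ b)) ≈-refl x a b) (contract (a ∙ b)
      (resp (solve 3 (λ x a b → (x ⊕ ((a ⊕ b) ⊕ (a ⊕ b))) ⊜ (((a ⊕ b) ⊕ (a ⊕ b)) ⊕ x)) ≈-refl x a b)
        (⟶₋⇒≤ r x∈ (a ∙ b , a ∙ b , valid⇒∈⟦⟧ vA Γ∈ Δ∈ , valid⇒∈⟦⟧ᗮ vB Γ∈ Δ∈ , refl))))

  valid-⇒R : ∀ {Γ Δ A B C} → Valid (A ∷ Γ) (B ∷ Δ) → _⟶₊_ R C (A ⇒ B) → Valid Γ (C ∷ Δ)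
  valid-⇒R {A = A} {B} v r {a} Γ∈ (_∷_ {x = y} {b} y∈ Δ∈) =
    resp (solve 3 (λ y a b → (y ⊕ (a ⊕ b)) ⊜ (a ⊕ (y ⊕ b))) ≈-refl y a b)
      (ᗮ-antitone (⟶₊⇒≥ r) y∈ ⇒∈)
    where
    ⇒∈ : ⟦ A ⇒ B ⟧ (a ∙ b)
    ⇒∈ (c , d , c∈ , d∈ , refl) =
      resp (solve 4 (λ c d a b → ((c ⊕ a) ⊕ (d ⊕ b)) ⊜ ((a ⊕ b) ⊕ (c ⊕ d))) ≈-refl c d a b)
        (v (c∈ ∷ Γ∈) (d∈ ∷ Δ∈))

  valid-∧L : ∀ {Γ Δ A B C} → Valid (A ∷ B ∷ Γ) Δ → _⟶₋_ R C (A ∧ B) → Valid (C ∷ Γ) Δ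
  valid-∧L {A = A} {B} v r {b = b} (_∷_ {x = x} {a} x∈ Γ∈) Δ∈ =
    resp (≈-sym (assoc x a b)) (⟶₋⇒≤ r x∈ ∧⊥)
    where
    ∧⊥ : ((⟦ A ⟧ ∩ ⟦ B ⟧) ᗮ) (a ∙ b)
    ∧⊥ {z} (z∈A , z∈B) =
      resp (comm z (a ∙ b)) (contract z
        (resp (solve 3 (λ z a b → ((z ⊕ (z ⊕ a)) ⊕ b) ⊜ ((z ⊕ z) ⊕ (a ⊕ b))) ≈-refl z a b)
          (v (z∈A ∷ z∈B ∷ Γ∈) Δ∈)))

  valid-∧R : ∀ {Γ Δ A B C} → Valid Γ (A ∷ Δ) → Valid Γ (B ∷ Δ) →
             _⟶₊_ R C (A ∧ B) → Valid Γ (C ∷ Δ)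
  valid-∧R {A = A} {B} vA vB r {a} Γ∈ (_∷_ {x = y} {b} y∈ Δ∈) =
    resp (solve 3 (λ y a b → (y ⊕ (a ⊕ b)) ⊜ (a ⊕ (y ⊕ b))) ≈-refl y a b)
      (ᗮ-antitone (⟶₊⇒≥ r) y∈ (⊆ᗮᗮ {⟦ A ⟧ ∩ ⟦ B ⟧} (valid⇒∈⟦⟧ vA Γ∈ Δ∈ , valid⇒∈⟦⟧ vB Γ∈ Δ∈)))

  valid-∨L : ∀ {Γ Δ A B C} → Valid (A ∷ Γ) Δ → Valid (B ∷ Γ) Δ →
             _⟶₋_ R C (A ∨ B) → Valid (C ∷ Γ) Δ
  valid-∨L vA vB r {b = b} (_∷_ {x = x} {a} x∈ Γ∈) Δ∈ =
    resp (≈-sym (assoc x a b)) (⟶₋⇒≤ r x∈ (valid⇒∈⟦⟧ᗮ vA Γ∈ Δ∈ , valid⇒∈⟦⟧ᗮ vB Γ∈ Δ∈))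

  valid-∨R : ∀ {Γ Δ A B C} → Valid Γ (A ∷ B ∷ Δ) → _⟶₊_ R C (A ∨ B) → Valid Γ (C ∷ Δ)
  valid-∨R {A = A} {B} v r {a} Γ∈ (_∷_ {x = y} {b} y∈ Δ∈) =
    resp (solve 3 (λ y a b → (y ⊕ (a ⊕ b)) ⊜ (a ⊕ (y ⊕ b))) ≈-refl y a b)
      (ᗮ-antitone (⟶₊⇒≥ r) y∈ ∨∈)
    where
    ∨∈ : ⟦ A ∨ B ⟧ (a ∙ b)
    ∨∈ {z} (z⊥A , z⊥B) =
      resp (comm z (a ∙ b)) (contract z
        (resp (solve 3 (λ z a b → (a ⊕ (z ⊕ (z ⊕ b))) ⊜ ((z ⊕ z) ⊕ (a ⊕ b))) ≈-refl z a b)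
          (v Γ∈ (z⊥A ∷ z⊥B ∷ Δ∈))))

  valid-⊥L : ∀ {Γ Δ A} → _⟶₋_ R A ⊥′ → Valid (A ∷ Γ) Δ
  valid-⊥L r {b = b} (_∷_ {x = x} {a} x∈ _) _ = resp (≈-sym (assoc x a b)) (⟶₋⇒≤ r x∈ tt)

  valid : ∀ {c Γ Δ} → Seq R c Γ Δ → Valid Γ Δ
  valid (perm d p q)       = valid-perm (valid d) p q
  valid (axiom r₋ r₊)      = valid-axiom r₋ r₊
  valid (cut _ d e r₋ r₊)  = valid-cut (valid d) (valid e) r₋ r₊
  valid (contrL d r₁ r₂)   = valid-contrL (valid d) r₁ r₂
  valid (contrR d r₁ r₂)   = valid-contrR (valid d) r₁ r₂
  valid (weakL d)          = valid-weakL (valid d)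
  valid (weakR d)          = valid-weakR (valid d)
  valid (⇒L d e r)         = valid-⇒L (valid d) (valid e) r
  valid (⇒R d r)           = valid-⇒R (valid d) r
  valid (∧L d r)           = valid-∧L (valid d) r
  valid (∧R d e r)         = valid-∧R (valid d) (valid e) r
  valid (∨L d e r)         = valid-∨L (valid d) (valid e) r
  valid (∨R d r)           = valid-∨R (valid d) r
  valid (⊥L r)             = valid-⊥L r

  lefts : ∀ Γ → Hyps Γ (Γ , [])
  lefts []      = []
  lefts (A ∷ Γ) = left∈⟦ A ⟧ ε ∷ lefts Γ

  rights : ∀ Δ → Concls Δ ([] , Δ)
  rights []      = []
  rights (A ∷ Δ) = right∈⟦ A ⟧ᗮ ε ∷ rights Δ

  cut-elimination : ∀ {c Γ Δ} → Seq R c Γ Δ → Seq R false Γ Δ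
  cut-elimination {Γ = Γ} {Δ} d =
    perm (valid d (lefts Γ) (rights Δ)) (↭-reflexive (++-identityʳ Γ)) ↭-refl

proposition7 : {Atom : Set} (R : RewriteSystem Atom) →
    (∀ (P : Atom) (A B : Form Atom) → neg R P A → pos R P B → ⊥) →
    Commute R
    × (∀ (Γ : List (Form Atom)) (π : Term) (A : Form Atom) → _⊢_∶_ R Γ π A → SN π)
    × (∀ (Γ Δ : List (Form Atom)) → Seq R true Γ Δ → Seq R false Γ Δ)
proposition7 R disjoint =
  commute R disjoint
  , (λ _ _ _ → StrongNormalization.strong-normalization R disjoint)
  , (λ _ _ → CutElimination.cut-elimination R disjoint)
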